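{- There is an absolute constant $c>0$ such that for every positive integer $N$ the following hold. (i) There exists a set $A\subseteq[N]$ with $|A|\geq cN^{1/2}$ such that no non-zero difference $a-a'$ ($a,a'\in A$) lies in $\{x^2+y^2: x,y\in\mathbb{Z}\}$. (ii) There exists a set $A\subseteq[N]$ with $|A|\geq cN^{1/4}$ such that no non-zero difference $a-a'$ ($a,a'\in A$) lies in $\{x_1^4+\dots+x_7^4: x_1,\dots,x_7\in\mathbb{Z}\}$.
   Context: $[N]=\{1,2,\dots,N\}$. -}

module Defs where

open import Data.Nat using (ℕ; _≤_; _*_; _^_)
open import Data.Integer as ℤ using (ℤ; +_)
open import Data.List using (List; length)
open import Data.List.Membership.Propositional using (_∈_)
open import Data.List.Relation.Unary.All using (All)
open import Data.List.Relation.Unary.Unique.Propositional using (Unique)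
open import Data.Product using (∃; ∃-syntax; _×_)
open import Relation.Binary.PropositionalEquality using (_≡_; _≢_)
open import Relation.Nullary using (¬_)

InRange : ℕ → ℕ → Set
InRange N a = 1 ≤ a × a ≤ N

-- A finite set A ⊆ [N], represented as a duplicate-free list; |A| = length A.
IsSubsetOfRange : ℕ → List ℕ → Set
IsSubsetOfRange N A = Unique A × All (InRange N) A

SumOfTwoSquares : ℤ → Set
SumOfTwoSquares z = ∃[ x ] ∃[ y ] z ≡ (x ℤ.^ 2) ℤ.+ (y ℤ.^ 2)

SumOfSevenFourthPowers : ℤ → Set
SumOfSevenFourthPowers z =
  ∃[ x₁ ] ∃[ x₂ ] ∃[ x₃ ] ∃[ x₄ ] ∃[ x₅ ] ∃[ x₆ ] ∃[ x₇ ]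
    z ≡ (x₁ ℤ.^ 4) ℤ.+ (x₂ ℤ.^ 4) ℤ.+ (x₃ ℤ.^ 4) ℤ.+ (x₄ ℤ.^ 4)
          ℤ.+ (x₅ ℤ.^ 4) ℤ.+ (x₆ ℤ.^ 4) ℤ.+ (x₇ ℤ.^ 4)

DifferenceFree : (ℤ → Set) → List ℕ → Set
DifferenceFree S A = ∀ {a a'} → a ∈ A → a' ∈ A → a ≢ a' → ¬ S ((+ a) ℤ.- (+ a'))

module Submission where

-- Write numbers in base b = r q using only the digits 0, q, 2q, ..., (r - 1) q: the k-digit
-- ones are r ^ k numbers below b ^ k.  Let P be a property with  P (q n) ⇒ n = r m, P m.
-- If two such numbers end in the same digit, their difference is b times the difference of
-- two shorter ones, to which P descends; otherwise the difference is a multiple of q, hence by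
-- P a multiple of b, although it is congruent to a non-zero digit difference modulo b.
-- Sums of two squares have this property for q = r = 3 and sums of seven fourth powers for
-- q = 8, r = 2, because modulo q each u ^ 2 resp. u ^ 4 is 0 or 1, and 0 only when 3 ∣ u
-- resp. 2 ∣ u; fewer than q such residues sum to a multiple of q only if all vanish.
-- As b = r ^ 2 resp. r ^ 4, the set has size about N ^ (1/2) resp. N ^ (1/4).

open import Defs
open import Data.Nat using (ℕ; _≤_; _*_; _^_)
open import Data.List using (List; length)
open import Data.Product using (Σ; ∃-syntax; _×_)

open import Data.Nat using (zero; suc; _+_; _∸_; _<_; _%_; s≤s; z≤n; z<s; s<s⁻¹; NonZero)
open import Data.Nat.Properties
open import Data.Nat.DivMod
  using (_mod_; m%n<n; m%n%n≡m%n; %-distribˡ-+; %-distribˡ-*; [m+kn]%n≡m%n; m<n⇒m%n≡m; m∣n⇒o%n%m≡o%m)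
open import Data.Nat.Divisibility
  using (_∣_; divides; ∣-refl; m%n≡0⇒n∣m; n∣m⇒m%n≡0; ∣m∣n⇒∣m+n; ∣m+n∣m⇒∣n; n∣m*n; ∣n⇒∣m*n)
open import Data.Nat.ListAction using (sum)
open import Data.Nat.Tactic.RingSolver using (solve-∀)
open import Data.Integer as ℤ using (ℤ; +_; -[1+_]; +[1+_]; ∣_∣)
import Data.Integer.Properties as ℤ
open import Algebra.Properties.AbelianGroup ℤ.+-0-abelianGroup using (//-rightDividesˡ)
open import Data.Fin as Fin using (Fin; toℕ)
open import Data.Fin.Properties using (toℕ-fromℕ<; toℕ<n; toℕ-injective; all?)
open import Data.List using ([]; _∷_; _++_; map; allFin; cartesianProductWith)
open import Data.List.Properties using (length-map; length-++; length-tabulate)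
open import Data.List.Membership.Propositional using (_∈_)
open import Data.List.Membership.Propositional.Properties using (∈-map⁻; ∈-cartesianProductWith⁻)
open import Data.List.Relation.Unary.All as All using (All; []; _∷_)
import Data.List.Relation.Unary.All.Properties as All
open import Data.List.Relation.Unary.Any using (here)
open import Data.List.Relation.Unary.AllPairs using ([]; _∷_)
open import Data.List.Relation.Unary.Unique.Propositional using (Unique)
import Data.List.Relation.Unary.Unique.Propositional.Properties as Unique
open import Data.Product using (_,_; proj₁; proj₂)
open import Data.Sum using (inj₁; inj₂)
open import Function using (_∘_; id)
open import Relation.Nullary using (¬_; Dec; yes; no)
open import Relation.Nullary.Decidable using (from-yes; _×-dec_; _→-dec_)
open import Relation.Binary.PropositionalEquality

%-distribˡ-^ : ∀ m n d .{{_ : NonZero d}} → m ^ n % d ≡ (m % d) ^ n % d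
%-distribˡ-^ m zero    d = refl
%-distribˡ-^ m (suc n) d = begin
  m * m ^ n % d                     ≡⟨ %-distribˡ-* m (m ^ n) d ⟩
  m % d * (m ^ n % d) % d           ≡⟨ cong (λ t → m % d * t % d) (%-distribˡ-^ m n d) ⟩
  m % d * ((m % d) ^ n % d) % d     ≡⟨ cong (λ t → t * ((m % d) ^ n % d) % d) (m%n%n≡m%n m d) ⟨
  m % d % d * ((m % d) ^ n % d) % d ≡⟨ %-distribˡ-* (m % d) ((m % d) ^ n) d ⟨
  m % d * (m % d) ^ n % d           ∎
  where open ≡-Reasoning

*-distribʳ-^ : ∀ m n o → (m * n) ^ o ≡ m ^ o * n ^ o
*-distribʳ-^ m n zero    = refl
*-distribʳ-^ m n (suc o) = begin
  m * n * (m * n) ^ o       ≡⟨ cong (m * n *_) (*-distribʳ-^ m n o) ⟩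
  m * n * (m ^ o * n ^ o)   ≡⟨ [m*n]*[o*p]≡[m*o]*[n*p] m n (m ^ o) (n ^ o) ⟩
  m * m ^ o * (n * n ^ o)   ∎
  where open ≡-Reasoning

[m^n]^o≡[m^o]^n : ∀ m n o → (m ^ n) ^ o ≡ (m ^ o) ^ n
[m^n]^o≡[m^o]^n m n o =
  trans (^-*-assoc m n o) (trans (cong (m ^_) (*-comm n o)) (sym (^-*-assoc m o n)))

power-bracket : ∀ b → 1 < b → ∀ N → 1 ≤ N → ∃[ k ] b ^ k ≤ N × N < b ^ suc k
power-bracket b 1<b (suc zero)    _ = 0 , ≤-refl , subst (1 <_) (sym (*-identityʳ b)) 1<b
power-bracket b 1<b (suc (suc N)) _ with power-bracket b 1<b (suc N) (s≤s z≤n)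
... | k , bᵏ≤N , N<bᵏ⁺¹ with m≤n⇒m<n∨m≡n N<bᵏ⁺¹
... | inj₁ N+1<bᵏ⁺¹ = k , m≤n⇒m≤1+n bᵏ≤N , N+1<bᵏ⁺¹
... | inj₂ N+1≡bᵏ⁺¹ = suc k , ≤-reflexive (sym N+1≡bᵏ⁺¹) , (begin-strict
  suc (suc N)           <⟨ m<m*n (suc (suc N)) b 1<b ⟩
  suc (suc N) * b       ≡⟨ *-comm (suc (suc N)) b ⟩
  b * suc (suc N)       ≡⟨ cong (b *_) N+1≡bᵏ⁺¹ ⟩
  b ^ suc (suc k)       ∎)
  where open ≤-Reasoning

sum-map-% : ∀ (f : ℕ → ℕ) d .{{_ : NonZero d}} xs →
            sum (map f xs) % d ≡ sum (map (λ x → f x % d) xs) % d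
sum-map-% f d []       = refl
sum-map-% f d (x ∷ xs) = begin
  (f x + sum (map f xs)) % d             ≡⟨ %-distribˡ-+ (f x) (sum (map f xs)) d ⟩
  (f x % d + sum (map f xs) % d) % d     ≡⟨ cong (λ t → (f x % d + t) % d) (sum-map-% f d xs) ⟩
  (f x % d + sum (map g xs) % d) % d
    ≡⟨ cong (λ t → (t + sum (map g xs) % d) % d) (m%n%n≡m%n (f x) d) ⟨
  (f x % d % d + sum (map g xs) % d) % d ≡⟨ %-distribˡ-+ (f x % d) (sum (map g xs)) d ⟨
  (f x % d + sum (map g xs)) % d         ∎
  where
  open ≡-Reasoning
  g : ℕ → ℕ
  g x = f x % d

sum-map-≤-length : ∀ (f : ℕ → ℕ) → (∀ x → f x ≤ 1) → ∀ xs → sum (map f xs) ≤ length xs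
sum-map-≤-length f f≤1 []       = z≤n
sum-map-≤-length f f≤1 (x ∷ xs) = +-mono-≤ (f≤1 x) (sum-map-≤-length f f≤1 xs)

sum-map≡0⇒All : ∀ (f : ℕ → ℕ) xs → sum (map f xs) ≡ 0 → All (λ x → f x ≡ 0) xs
sum-map≡0⇒All f []       _ = []
sum-map≡0⇒All f (x ∷ xs) s≡0 =
  m+n≡0⇒m≡0 (f x) s≡0 ∷ sum-map≡0⇒All f xs (m+n≡0⇒n≡0 (f x) s≡0)

All-∣⇒≡map-* : ∀ {d xs} → All (d ∣_) xs → ∃[ ys ] xs ≡ map (_* d) ys
All-∣⇒≡map-* []                  = [] , refl
All-∣⇒≡map-* (divides y refl ∷ ds) with All-∣⇒≡map-* ds
... | ys , refl = y ∷ ys , refl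

sum-map-^-* : ∀ e d xs → sum (map (_^ e) (map (_* d) xs)) ≡ sum (map (_^ e) xs) * d ^ e
sum-map-^-* e d []       = refl
sum-map-^-* e d (x ∷ xs) = begin
  (x * d) ^ e + sum (map (_^ e) (map (_* d) xs)) ≡⟨ cong₂ _+_ (*-distribʳ-^ x d e) (sum-map-^-* e d xs) ⟩
  x ^ e * d ^ e + sum (map (_^ e) xs) * d ^ e    ≡⟨ *-distribʳ-+ (d ^ e) (x ^ e) (sum (map (_^ e) xs)) ⟨
  (x ^ e + sum (map (_^ e) xs)) * d ^ e          ∎
  where open ≡-Reasoning

length-cartesianProductWith : ∀ {A B C : Set} (f : A → B → C) xs ys →
                              length (cartesianProductWith f xs ys) ≡ length xs * length ys
length-cartesianProductWith f []       ys = refl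
length-cartesianProductWith f (x ∷ xs) ys = begin
  length (map (f x) ys ++ cartesianProductWith f xs ys)        ≡⟨ length-++ (map (f x) ys) ⟩
  length (map (f x) ys) + length (cartesianProductWith f xs ys)
    ≡⟨ cong₂ _+_ (length-map (f x) ys) (length-cartesianProductWith f xs ys) ⟩
  length ys + length xs * length ys                             ∎
  where open ≡-Reasoning

PowerResidueIndicator : (e q p : ℕ) .{{_ : NonZero q}} → Set
PowerResidueIndicator e q p = ∀ u → u ^ e % q ≤ 1 × (u ^ e % q ≡ 0 → p ∣ u)

ResidueTable : (e q p : ℕ) .{{_ : NonZero q}} .{{_ : NonZero p}} → Set
ResidueTable e q p = ∀ (r : Fin q) → toℕ r ^ e % q ≤ 1 × (toℕ r ^ e % q ≡ 0 → toℕ r % p ≡ 0)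

residueTable? : ∀ e q p .{{_ : NonZero q}} .{{_ : NonZero p}} → Dec (ResidueTable e q p)
residueTable? e q p =
  all? λ r → (toℕ r ^ e % q ≤? 1) ×-dec ((toℕ r ^ e % q ≟ 0) →-dec (toℕ r % p ≟ 0))

residueTable⇒powerResidueIndicator : ∀ e q p .{{_ : NonZero q}} .{{_ : NonZero p}} → p ∣ q →
                                     ResidueTable e q p → PowerResidueIndicator e q p
residueTable⇒powerResidueIndicator e q p p∣q table u =
  subst (_≤ 1) (sym uᵉ%q≡rᵉ%q) (proj₁ (table r)) , p∣u
  where
  open ≡-Reasoning
  r : Fin q
  r = u mod q
  r≡u%q : toℕ r ≡ u % q
  r≡u%q = toℕ-fromℕ< (m%n<n u q)
  uᵉ%q≡rᵉ%q : u ^ e % q ≡ toℕ r ^ e % q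
  uᵉ%q≡rᵉ%q = trans (%-distribˡ-^ u e q) (cong (λ t → t ^ e % q) (sym r≡u%q))
  p∣u : u ^ e % q ≡ 0 → p ∣ u
  p∣u uᵉ%q≡0 = m%n≡0⇒n∣m u p (begin
    u % p         ≡⟨ m∣n⇒o%n%m≡o%m p q u p∣q ⟨
    u % q % p     ≡⟨ cong (_% p) r≡u%q ⟨
    toℕ r % p     ≡⟨ proj₂ (table r) (trans (sym uᵉ%q≡rᵉ%q) uᵉ%q≡0) ⟩
    0             ∎)

squares-mod-3 : PowerResidueIndicator 2 3 3
squares-mod-3 =
  residueTable⇒powerResidueIndicator 2 3 3 ∣-refl (from-yes (residueTable? 2 3 3))

fourthPowers-mod-8 : PowerResidueIndicator 4 8 2
fourthPowers-mod-8 =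
  residueTable⇒powerResidueIndicator 4 8 2 (divides 4 refl) (from-yes (residueTable? 4 8 2))

IsSumOfPowers : (e k n : ℕ) → Set
IsSumOfPowers e k n = ∃[ us ] length us ≡ k × sum (map (_^ e) us) ≡ n

module _ (e q p : ℕ) .{{_ : NonZero q}} (indicator : PowerResidueIndicator e q p) where

  q∣sumOfPowers⇒All-p∣ : ∀ us → length us < q → q ∣ sum (map (_^ e) us) → All (p ∣_) us
  q∣sumOfPowers⇒All-p∣ us |us|<q q∣Σ =
    All.map (λ {u} → proj₂ (indicator u)) (sum-map≡0⇒All residue us t≡0)
    where
    open ≡-Reasoning
    residue : ℕ → ℕ
    residue u = u ^ e % q
    t : ℕ
    t = sum (map residue us)
    t<q : t < q
    t<q = ≤-<-trans (sum-map-≤-length residue (proj₁ ∘ indicator) us) |us|<q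
    t≡0 : t ≡ 0
    t≡0 = begin
      t                        ≡⟨ m<n⇒m%n≡m t<q ⟨
      t % q                    ≡⟨ sum-map-% (_^ e) q us ⟨
      sum (map (_^ e) us) % q  ≡⟨ n∣m⇒m%n≡0 _ q q∣Σ ⟩
      0                        ∎

  isSumOfPowers-descent : ∀ {k r n} → k < q → p ^ e ≡ r * q →
                          IsSumOfPowers e k (n * q) → ∃[ m ] n ≡ m * r × IsSumOfPowers e k m
  isSumOfPowers-descent {r = r} {n} k<q pᵉ≡rq (us , refl , Σ≡nq)
    with All-∣⇒≡map-* (q∣sumOfPowers⇒All-p∣ us k<q (divides n Σ≡nq))
  ... | vs , refl = S , *-cancelʳ-≡ n (S * r) q nq≡Srq , vs , sym (length-map (_* p) vs) , refl
    where
    open ≡-Reasoning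
    S : ℕ
    S = sum (map (_^ e) vs)
    nq≡Srq : n * q ≡ S * r * q
    nq≡Srq = begin
      n * q                            ≡⟨ Σ≡nq ⟨
      sum (map (_^ e) (map (_* p) vs)) ≡⟨ sum-map-^-* e p vs ⟩
      S * p ^ e                        ≡⟨ cong (S *_) pᵉ≡rq ⟩
      S * (r * q)                      ≡⟨ *-assoc S r q ⟨
      S * r * q                        ∎

sumOfTwoSquares-descent : ∀ {n} → IsSumOfPowers 2 2 (n * 3) →
                          ∃[ m ] n ≡ m * 3 × IsSumOfPowers 2 2 m
sumOfTwoSquares-descent = isSumOfPowers-descent 2 3 3 squares-mod-3 (from-yes (2 <? 3)) refl

sumOfSevenFourthPowers-descent : ∀ {n} → IsSumOfPowers 4 7 (n * 8) →
                                 ∃[ m ] n ≡ m * 2 × IsSumOfPowers 4 7 m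
sumOfSevenFourthPowers-descent = isSumOfPowers-descent 4 8 2 fourthPowers-mod-8 (from-yes (7 <? 8)) refl

DifferenceFreeℕ : (ℕ → Set) → List ℕ → Set
DifferenceFreeℕ P A = ∀ {a a'} → a ∈ A → a' ∈ A → a' < a → ¬ P (a ∸ a')

module DigitExpansion (q r : ℕ) .{{_ : NonZero q}} .{{_ : NonZero r}} where

  base : ℕ
  base = r * q

  instance
    base≢0 : NonZero base
    base≢0 = m*n≢0 r q

  -- digitSet k lists the numbers below base ^ k whose base-(r q) digits all lie in
  -- {0, q, ..., (r - 1) q}; place i x has last digit (toℕ i) q and leading digits x.
  place : Fin r → ℕ → ℕ
  place i x = toℕ i * q + x * base

  digitSet : ℕ → List ℕ
  digitSet zero    = 0 ∷ []
  digitSet (suc k) = cartesianProductWith place (allFin r) (digitSet k)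

  place-%-base : ∀ i x → place i x % base ≡ toℕ i * q
  place-%-base i x = trans ([m+kn]%n≡m%n (toℕ i * q) x base) (m<n⇒m%n≡m (*-monoˡ-< q (toℕ<n i)))

  place-injective : ∀ {i j x y} → place i x ≡ place j y → i ≡ j × x ≡ y
  place-injective {i} {j} {x} {y} eq =
    toℕ-injective (*-cancelʳ-≡ (toℕ i) (toℕ j) q iq≡jq) ,
    *-cancelʳ-≡ x y base (+-cancelˡ-≡ (toℕ i * q) _ _ (trans eq (cong (_+ y * base) (sym iq≡jq))))
    where
    iq≡jq : toℕ i * q ≡ toℕ j * q
    iq≡jq = trans (sym (place-%-base i x)) (trans (cong (_% base) eq) (place-%-base j y))

  q∣place : ∀ i x → q ∣ place i x
  q∣place i x = ∣m∣n⇒∣m+n (n∣m*n (toℕ i)) (∣n⇒∣m*n x (n∣m*n r))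

  q∣place-∸ : ∀ i x j y → place j y ≤ place i x → q ∣ place i x ∸ place j y
  q∣place-∸ i x j y a'≤a =
    ∣m+n∣m⇒∣n (subst (q ∣_) (sym (m+[n∸m]≡n a'≤a)) (q∣place i x)) (q∣place j y)

  length-digitSet : ∀ k → length (digitSet k) ≡ r ^ k
  length-digitSet zero    = refl
  length-digitSet (suc k) = begin
    length (cartesianProductWith place (allFin r) (digitSet k))
      ≡⟨ length-cartesianProductWith place (allFin r) (digitSet k) ⟩
    length (allFin r) * length (digitSet k)
      ≡⟨ cong₂ _*_ (length-tabulate {n = r} id) (length-digitSet k) ⟩
    r * r ^ k
      ∎
    where open ≡-Reasoning

  digitSet-unique : ∀ k → Unique (digitSet k)
  digitSet-unique zero    = [] ∷ []
  digitSet-unique (suc k) =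
    Unique.cartesianProductWith⁺ place place-injective (Unique.allFin⁺ r) (digitSet-unique k)

  digitSet-< : ∀ k {a} → a ∈ digitSet k → a < base ^ k
  digitSet-< zero    (here refl) = z<s
  digitSet-< (suc k) a∈ with ∈-cartesianProductWith⁻ place (allFin r) (digitSet k) a∈
  ... | i , x , _ , x∈ , refl = begin-strict
    toℕ i * q + x * base <⟨ +-monoˡ-< (x * base) (*-monoˡ-< q (toℕ<n i)) ⟩
    base + x * base      ≤⟨ *-monoˡ-≤ base (digitSet-< k x∈) ⟩
    base ^ k * base      ≡⟨ *-comm (base ^ k) base ⟩
    base ^ suc k         ∎
    where open ≤-Reasoning

  module _ (P : ℕ → Set) (descent : ∀ {n} → P (n * q) → ∃[ m ] n ≡ m * r × P m) where

    descent-base : ∀ {n} → P (n * base) → P n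
    descent-base {n} Pnb with descent (subst P (sym (*-assoc n r q)) Pnb)
    ... | m , nr≡mr , Pm = subst P (sym (*-cancelʳ-≡ n m r nr≡mr)) Pm

    q∣⇒base∣ : ∀ {n} → P n → q ∣ n → ∃[ m ] n ≡ m * base
    q∣⇒base∣ Pn (divides n' refl) with descent {n'} Pn
    ... | m , refl , _ = m , *-assoc m r q

    P-difference⇒sameDigit : ∀ i x j y → place j y ≤ place i x → P (place i x ∸ place j y) → i ≡ j
    P-difference⇒sameDigit i x j y a'≤a Pd with q∣⇒base∣ Pd (q∣place-∸ i x j y a'≤a)
    ... | m , d≡m*base = proj₁ (place-injective {x = x} {y = m + y} (begin
      place i x                              ≡⟨ m+[n∸m]≡n a'≤a ⟨
      place j y + (place i x ∸ place j y)    ≡⟨ cong (_+_ (place j y)) d≡m*base ⟩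
      toℕ j * q + y * base + m * base        ≡⟨ rearrange (toℕ j * q) y m base ⟩
      place j (m + y)                        ∎))
      where
      open ≡-Reasoning
      rearrange : ∀ c y m b → c + y * b + m * b ≡ c + (m + y) * b
      rearrange = solve-∀

    digitSet-differenceFree : ∀ k → DifferenceFreeℕ P (digitSet k)
    digitSet-differenceFree zero    (here refl) (here refl) ()
    digitSet-differenceFree (suc k) a∈ a'∈ a'<a Pd
      with ∈-cartesianProductWith⁻ place (allFin r) (digitSet k) a∈
         | ∈-cartesianProductWith⁻ place (allFin r) (digitSet k) a'∈
    ... | i , x , _ , x∈ , refl | j , y , _ , y∈ , refl with i Fin.≟ j
    ... | yes refl = digitSet-differenceFree k x∈ y∈ y<x (descent-base (subst P sameDigit Pd))
      where
      y<x : y < x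
      y<x = *-cancelʳ-< base y x (+-cancelˡ-< (toℕ i * q) (y * base) (x * base) a'<a)
      sameDigit : place i x ∸ place i y ≡ (x ∸ y) * base
      sameDigit = trans ([m+n]∸[m+o]≡n∸o (toℕ i * q) (x * base) (y * base))
                        (sym (*-distribʳ-∸ base x y))
    ... | no i≢j = i≢j (P-difference⇒sameDigit i x j y (<⇒≤ a'<a) Pd)

differenceFreeℕ-map-suc : ∀ {P A} → DifferenceFreeℕ P A → DifferenceFreeℕ P (map suc A)
differenceFreeℕ-map-suc free a∈ a'∈ a'<a with ∈-map⁻ suc a∈ | ∈-map⁻ suc a'∈
... | x , x∈ , refl | y , y∈ , refl = free x∈ y∈ (s<s⁻¹ a'<a)

differenceFree-fromℕ : ∀ {S P A} → (∀ {z} → S z → ∃[ n ] z ≡ + n × P n) →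
                       DifferenceFreeℕ P A → DifferenceFree S A
differenceFree-fromℕ {P = P} S⇒P free {a} {a'} a∈ a'∈ a≢a' Sd with S⇒P Sd
... | n , d≡n , Pn = free a∈ a'∈ a'<a (subst P (sym a∸a'≡n) Pn)
  where
  open ≡-Reasoning
  a≡n+a' : a ≡ n + a'
  a≡n+a' = ℤ.+-injective (begin
    + a                         ≡⟨ //-rightDividesˡ (+ a') (+ a) ⟨
    (+ a ℤ.- + a') ℤ.+ + a'     ≡⟨ cong (ℤ._+ + a') d≡n ⟩
    + n ℤ.+ + a'                ∎)
  a'<a : a' < a
  a'<a = ≤∧≢⇒< (subst (a' ≤_) (sym a≡n+a') (m≤n+m a' n)) (a≢a' ∘ sym)
  a∸a'≡n : a ∸ a' ≡ n
  a∸a'≡n = trans (cong (_∸ a') a≡n+a') (m+n∸n≡m n a')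

i^2≡+∣i∣^2 : ∀ i → i ℤ.^ 2 ≡ + (∣ i ∣ ^ 2)
i^2≡+∣i∣^2 (+ zero)  = refl
i^2≡+∣i∣^2 +[1+ n ]  = refl
i^2≡+∣i∣^2 -[1+ n ]  = refl

i^4≡+∣i∣^4 : ∀ i → i ℤ.^ 4 ≡ + (∣ i ∣ ^ 4)
i^4≡+∣i∣^4 (+ zero)  = refl
i^4≡+∣i∣^4 +[1+ n ]  = refl
i^4≡+∣i∣^4 -[1+ n ]  = refl

sumOfTwoSquares⇒ℕ : ∀ {z} → SumOfTwoSquares z → ∃[ n ] z ≡ + n × IsSumOfPowers 2 2 n
sumOfTwoSquares⇒ℕ (x , y , refl) =
  _ , cong₂ ℤ._+_ (i^2≡+∣i∣^2 x) (i^2≡+∣i∣^2 y) ,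
  ∣ x ∣ ∷ ∣ y ∣ ∷ [] , refl , cong (_+_ (∣ x ∣ ^ 2)) (+-identityʳ (∣ y ∣ ^ 2))

sumOfSevenFourthPowers⇒ℕ : ∀ {z} → SumOfSevenFourthPowers z → ∃[ n ] z ≡ + n × IsSumOfPowers 4 7 n
sumOfSevenFourthPowers⇒ℕ (x₁ , x₂ , x₃ , x₄ , x₅ , x₆ , x₇ , refl)
  rewrite i^4≡+∣i∣^4 x₁ | i^4≡+∣i∣^4 x₂ | i^4≡+∣i∣^4 x₃ | i^4≡+∣i∣^4 x₄
        | i^4≡+∣i∣^4 x₅ | i^4≡+∣i∣^4 x₆ | i^4≡+∣i∣^4 x₇ =
  -- + m ℤ.+ + n computes to + (m + n).
  _ , refl , ∣ x₁ ∣ ∷ ∣ x₂ ∣ ∷ ∣ x₃ ∣ ∷ ∣ x₄ ∣ ∷ ∣ x₅ ∣ ∷ ∣ x₆ ∣ ∷ ∣ x₇ ∣ ∷ [] , refl ,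
  reassociate (∣ x₁ ∣ ^ 4) (∣ x₂ ∣ ^ 4) (∣ x₃ ∣ ^ 4) (∣ x₄ ∣ ^ 4) (∣ x₅ ∣ ^ 4) (∣ x₆ ∣ ^ 4) (∣ x₇ ∣ ^ 4)
  where
  reassociate : ∀ a b c d e f g → a + (b + (c + (d + (e + (f + (g + 0)))))) ≡ a + b + c + d + e + f + g
  reassociate = solve-∀

large-differenceFree-subset :
  ∀ r e .{{_ : NonZero r}} → 1 < r → {S : ℤ → Set} {P : ℕ → Set} →
  (∀ {z} → S z → ∃[ n ] z ≡ + n × P n) →
  (∀ {n} → P (n * r ^ e) → ∃[ m ] n ≡ m * r × P m) →
  ∀ N → 1 ≤ N → ∃[ A ] IsSubsetOfRange N A × N ≤ (r * length A) ^ suc e × DifferenceFree S A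
large-differenceFree-subset r e 1<r {S} {P} S⇒P descent N 1≤N
  with power-bracket (r ^ suc e) (<-≤-trans 1<r (m≤m*n r (r ^ e) {{m^n≢0 r e}})) N 1≤N
... | k , bᵏ≤N , N<bᵏ⁺¹ =
  A , (unique , inRange) , N≤ ,
  differenceFree-fromℕ S⇒P (differenceFreeℕ-map-suc {P} (digitSet-differenceFree P descent k))
  where
  open DigitExpansion (r ^ e) r {{m^n≢0 r e}}
  A : List ℕ
  A = map suc (digitSet k)
  unique : Unique A
  unique = Unique.map⁺ suc-injective (digitSet-unique k)
  inRange : All (InRange N) A
  inRange = All.map⁺ (All.tabulate λ a∈ → s≤s z≤n , ≤-trans (digitSet-< k a∈) bᵏ≤N)
  |A|≡rᵏ : length A ≡ r ^ k
  |A|≡rᵏ = trans (length-map suc (digitSet k)) (length-digitSet k)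
  N≤ : N ≤ (r * length A) ^ suc e
  N≤ = begin
    N                      ≤⟨ <⇒≤ N<bᵏ⁺¹ ⟩
    (r ^ suc e) ^ suc k    ≡⟨ [m^n]^o≡[m^o]^n r (suc e) (suc k) ⟩
    (r * r ^ k) ^ suc e    ≡⟨ cong (λ t → (r * t) ^ suc e) |A|≡rᵏ ⟨
    (r * length A) ^ suc e ∎
    where open ≤-Reasoning

theorem1p3 : Σ ℕ λ m → 1 ≤ m × ((N : ℕ) → 1 ≤ N →
    (∃[ A ] IsSubsetOfRange N A × N ≤ (m * length A) ^ 2 × DifferenceFree SumOfTwoSquares A)
    × (∃[ A ] IsSubsetOfRange N A × N ≤ (m * length A) ^ 4 × DifferenceFree SumOfSevenFourthPowers A))
theorem1p3 = 3 , s≤s z≤n , λ N 1≤N →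
  large-differenceFree-subset 3 1 (from-yes (1 <? 3))
    sumOfTwoSquares⇒ℕ sumOfTwoSquares-descent N 1≤N ,
  widen (large-differenceFree-subset 2 3 (from-yes (1 <? 2))
    sumOfSevenFourthPowers⇒ℕ sumOfSevenFourthPowers-descent N 1≤N)
  where
  widen : ∀ {N} →
    ∃[ A ] IsSubsetOfRange N A × N ≤ (2 * length A) ^ 4 × DifferenceFree SumOfSevenFourthPowers A →
    ∃[ A ] IsSubsetOfRange N A × N ≤ (3 * length A) ^ 4 × DifferenceFree SumOfSevenFourthPowers A
  widen (A , A⊆[N] , N≤ , free) =
    A , A⊆[N] , ≤-trans N≤ (^-monoˡ-≤ 4 (*-monoˡ-≤ (length A) (from-yes (2 ≤? 3)))) , free
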